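{- Let $G$ be a finite simple undirected graph and $x\in V_G$. Then \[\operatorname{nlcw}(G)-1\le\operatorname{nlcw}(S(G,x))\le\operatorname{nlcw}(G)+1\quad\text{and}\quad \tfrac12\operatorname{cw}(G)\le\operatorname{cw}(S(G,x))\le 2\operatorname{cw}(G).\]
   Context: Switching: $S(G,x)$ has vertex set $V_G$ and edge set $E_G\setminus\{\{x,y\}:\{x,y\}\in E_G\}\cup\{\{x,y\}: y\in V_G,\ y\neq x,\ \{x,y\}\notin E_G\}$; i.e. the neighborhood of $x$ is replaced by its complement in $V_G\setminus\{x\}$, all other adjacencies unchanged. Clique-width: for a positive integer $k$, $\mathrm{CW}_k$ is the smallest class of graphs whose vertices carry labels from $\{1,\dots,k\}$ that contains every single-vertex graph with any label and is closed under: disjoint union; relabeling $\rho_{a\to b}$ for $a\neq b$; and $\eta_{a,b}$ for $a\neq b$ (add all edges between vertices labeled $a$ and vertices labeled $b$). $\operatorname{cw}(G)$ is the least $k$ such that some labeling of $G$ lies in $\mathrm{CW}_k$. NLC-width: $\mathrm{NLC}_k$ is the smallest class of labeled graphs (labels in $\{1,\dots,k\}$) containing every single-vertex graph with any label and closed under: $G\times_S J$ for $S\subseteq\{1,\dots,k\}^2$ (disjoint union of vertex-disjoint $G$ and $J$ plus all edges $\{u,v\}$, $u\in V_G$, $v\in V_J$, $(\mathrm{lab}(u),\mathrm{lab}(v))\in S$); and $\circ_R$ for $R:\{1,\dots,k\}\to\{1,\dots,k\}$. $\operatorname{nlcw}(G)$ is the least $k$ such that some labeling of $G$ lies in $\mathrm{NLC}_k$.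 -}

module Defs where

open import Data.Nat using (ℕ; _+_)
open import Data.Fin using (Fin; splitAt; _≟_)
open import Data.Bool using (Bool; true; false; not; _∧_; _∨_; _xor_; if_then_else_)
open import Data.Bool.Properties using (xor-comm)
open import Data.Sum using (inj₁; inj₂)
open import Data.Product using (Σ; _×_)
open import Relation.Nullary using (¬_)
open import Relation.Nullary.Decidable using (⌊_⌋)
open import Relation.Binary.PropositionalEquality using (_≡_; _≢_; refl; cong₂)
open import Function.Bundles using (_↔_; Inverse)
open import Data.Nat using (_≤_)

record Graph (n : ℕ) : Set where
  field
    adj    : Fin n → Fin n → Bool
    sym    : ∀ u v → adj u v ≡ adj v u
    irrefl : ∀ v → adj v v ≡ false

open Graph public

-- Switching S(G,x): the neighbourhood of x is complemented in V ∖ {x};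
-- an edge {u,v} is flipped iff exactly one of u, v equals x.

isX : ∀ {n} → Fin n → Fin n → Bool
isX x u = ⌊ u ≟ x ⌋

private
  xor-self : ∀ b → b xor b ≡ false
  xor-self true  = refl
  xor-self false = refl

  sw-irrefl : ∀ a b → a ≡ false → a xor (b xor b) ≡ false
  sw-irrefl a b refl = xor-self b

switch : ∀ {n} → Graph n → Fin n → Graph n
switch G x = record
  { adj    = λ u v → adj G u v xor (isX x u xor isX x v)
  ; sym    = λ u v → cong₂ _xor_ (Graph.sym G u v) (xor-comm (isX x u) (isX x v))
  ; irrefl = λ v → sw-irrefl (adj G v v) (isX x v) (Graph.irrefl G v)
  }

_==_ : ∀ {k} → Fin k → Fin k → Bool
a == b = ⌊ a ≟ b ⌋

-- Clique-width expressions with labels in Fin k; the index is the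
-- number of vertices of the generated graph (vertices are Fin m).

data CWExpr (k : ℕ) : ℕ → Set where
  cw-vtx   : Fin k → CWExpr k 1
  cw-union : ∀ {m p} → CWExpr k m → CWExpr k p → CWExpr k (m + p)
  cw-relab : ∀ {m} (a b : Fin k) → a ≢ b → CWExpr k m → CWExpr k m
  cw-join  : ∀ {m} (a b : Fin k) → a ≢ b → CWExpr k m → CWExpr k m

cwLabel : ∀ {k m} → CWExpr k m → Fin m → Fin k
cwLabel (cw-vtx a) _ = a
cwLabel (cw-union {m} s t) u with splitAt m u
... | inj₁ u₁ = cwLabel s u₁
... | inj₂ u₂ = cwLabel t u₂
cwLabel (cw-relab a b _ t) u = if cwLabel t u == a then b else cwLabel t u
cwLabel (cw-join _ _ _ t) u = cwLabel t u

cwEdge : ∀ {k m} → CWExpr k m → Fin m → Fin m → Bool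
cwEdge (cw-vtx _) _ _ = false
cwEdge (cw-union {m} s t) u v with splitAt m u | splitAt m v
... | inj₁ u₁ | inj₁ v₁ = cwEdge s u₁ v₁
... | inj₂ u₂ | inj₂ v₂ = cwEdge t u₂ v₂
... | inj₁ _  | inj₂ _  = false
... | inj₂ _  | inj₁ _  = false
cwEdge (cw-relab _ _ _ t) u v = cwEdge t u v
cwEdge (cw-join a b _ t) u v =
  cwEdge t u v ∨ ((cwLabel t u == a) ∧ (cwLabel t v == b))
               ∨ ((cwLabel t u == b) ∧ (cwLabel t v == a))

data NLCExpr (k : ℕ) : ℕ → Set where
  nlc-vtx   : Fin k → NLCExpr k 1
  nlc-join  : ∀ {m p} → (Fin k → Fin k → Bool) → NLCExpr k m → NLCExpr k p → NLCExpr k (m + p)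
  nlc-relab : ∀ {m} → (Fin k → Fin k) → NLCExpr k m → NLCExpr k m

nlcLabel : ∀ {k m} → NLCExpr k m → Fin m → Fin k
nlcLabel (nlc-vtx a) _ = a
nlcLabel (nlc-join {m} _ s t) u with splitAt m u
... | inj₁ u₁ = nlcLabel s u₁
... | inj₂ u₂ = nlcLabel t u₂
nlcLabel (nlc-relab R t) u = R (nlcLabel t u)

nlcEdge : ∀ {k m} → NLCExpr k m → Fin m → Fin m → Bool
nlcEdge (nlc-vtx _) _ _ = false
nlcEdge (nlc-join {m} S s t) u v with splitAt m u | splitAt m v
... | inj₁ u₁ | inj₁ v₁ = nlcEdge s u₁ v₁
... | inj₂ u₂ | inj₂ v₂ = nlcEdge t u₂ v₂
... | inj₁ u₁ | inj₂ v₂ = S (nlcLabel s u₁) (nlcLabel t v₂)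
... | inj₂ u₂ | inj₁ v₁ = S (nlcLabel s v₁) (nlcLabel t u₂)
nlcEdge (nlc-relab _ t) u v = nlcEdge t u v

InCW : ∀ {n} → Graph n → ℕ → Set
InCW {n} G k =
  Σ ℕ λ m → Σ (CWExpr k m) λ t → Σ (Fin n ↔ Fin m) λ f →
    ∀ u v → adj G u v ≡ cwEdge t (Inverse.to f u) (Inverse.to f v)

InNLC : ∀ {n} → Graph n → ℕ → Set
InNLC {n} G k =
  Σ ℕ λ m → Σ (NLCExpr k m) λ t → Σ (Fin n ↔ Fin m) λ f →
    ∀ u v → adj G u v ≡ nlcEdge t (Inverse.to f u) (Inverse.to f v)

IsCW : ∀ {n} → Graph n → ℕ → Set
IsCW G k = InCW G k × (∀ j → InCW G j → k ≤ j)

IsNLCW : ∀ {n} → Graph n → ℕ → Set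
IsNLCW G k = InNLC G k × (∀ j → InNLC G j → k ≤ j)

-- Switching at x is an involution, so it suffices to show nlcw(S(G,x)) ≤ nlcw(G) + 1 and
-- cw(S(G,x)) ≤ 2 cw(G).
-- NLC-width: in an expression for G give x a fresh label; at the operation ×_S that joins
-- the operand containing x to the other one, complement the row (or column) of x in S.
-- Clique-width: delete x from a k-expression for G and double the labels, a vertex v
-- getting the label (l, f) where f tells whether v is adjacent to x in S(G,x); every
-- relabelling and join is performed for both values of the flags, so the graph is unchanged.
-- Then x is put back with the label (0, false), which no vertex carries (for k ≥ 2 after
-- relabelling it to (1, false); for k = 1 the graph G is edgeless, so every flag is true),
-- and x is joined with every label (l, true).

module Submission where

open import Defs hiding (sym)
open import Data.Nat using (ℕ; _≤_; _+_; _*_; _∸_)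
open import Data.Fin using (Fin)
open import Data.Product using (_×_)

open import Data.Nat using (zero; suc)
open import Data.Nat.Properties using (+-comm; m≤n+o⇒m∸n≤o)
open import Data.Fin using (zero; suc; splitAt; join; lift; combine; remQuot; _↑ˡ_; _↑ʳ_; _≟_)
open import Data.Fin.Properties using (0≢1+n; +↔⊎; ↑ˡ-injective; ↑ʳ-injective; remQuot-combine)
open import Data.Fin.Properties using (splitAt-↑ˡ; splitAt-↑ʳ; splitAt⁻¹-↑ˡ; splitAt⁻¹-↑ʳ; join-splitAt; splitAt-join)
open import Data.Bool using (Bool; true; false; not; T; _∧_; _∨_; _xor_; if_then_else_)
open import Data.Bool.Properties using (xor-comm; xor-assoc; xor-same; xor-identityʳ)
open import Data.Bool.Properties using (if-float; ∨-assoc; ∨-identityʳ; T-≡)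
open import Data.Sum using (_⊎_; inj₁; inj₂; [_,_]′)
import Data.Sum as Sum
open import Data.Sum.Properties using (inj₁-injective; inj₂-injective)
open import Data.Empty using (⊥; ⊥-elim)
open import Data.List using (List; []; _∷_; allFin)
open import Data.List.Relation.Unary.Any using (Any; any?; satisfied)
import Data.List.Relation.Unary.Any as Any
open import Data.List.Membership.Propositional.Properties using (∈-allFin)
open import Data.Product using (∃; _,_; proj₁; proj₂)
open import Data.Product.Properties using (,-injective)
import Data.Product as Product
open import Function using (id; _∘_; const)
open import Function.Bundles using (_↔_; _⇔_; Inverse; Injection; Equivalence; mk⇔; mk↔ₛ′)
open import Function.Definitions using (Injective)
open import Function.Properties.Inverse using (↔⇒↣; ↔-sym)
open import Function.Construct.Composition using (_↔-∘_)
open import Relation.Nullary using (¬_; Dec; yes; no; does; _×-dec_; _⊎-dec_)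
open import Relation.Nullary.Decidable using (T?; isYes≗does; dec-true; dec-false; does-⇔)
open import Relation.Binary.PropositionalEquality

private
  variable
    k m m′ n n′ : ℕ

==-≡ : {a b : Fin k} → a ≡ b → (a == b) ≡ true
==-≡ {a = a} {b} a≡b = trans (isYes≗does (a ≟ b)) (dec-true (a ≟ b) a≡b)

==-≢ : {a b : Fin k} → a ≢ b → (a == b) ≡ false
==-≢ {a = a} {b} a≢b = trans (isYes≗does (a ≟ b)) (dec-false (a ≟ b) a≢b)

==-injective : {f : Fin m → Fin n} → Injective _≡_ _≡_ f → ∀ a b → (f a == f b) ≡ (a == b)
==-injective f-inj a b with a ≟ b
... | yes refl = ==-≡ refl
... | no a≢b   = ==-≢ (a≢b ∘ f-inj)

↑ˡ≢↑ʳ : ∀ (i : Fin m) (j : Fin n) → i ↑ˡ n ≢ m ↑ʳ j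
↑ˡ≢↑ʳ {m} {n} i j eq
  with () ← trans (sym (splitAt-↑ˡ m i n)) (trans (cong (splitAt m) eq) (splitAt-↑ʳ m n j))

_==⊎_ : Fin m ⊎ Fin n → Fin m ⊎ Fin n → Bool
inj₁ i ==⊎ inj₁ j = i == j
inj₁ _ ==⊎ inj₂ _ = false
inj₂ _ ==⊎ inj₁ _ = false
inj₂ i ==⊎ inj₂ j = i == j

join-== : ∀ (s t : Fin m ⊎ Fin n) → (join m n s == join m n t) ≡ (s ==⊎ t)
join-== {n = n} (inj₁ i) (inj₁ j) = ==-injective (↑ˡ-injective n _ _) i j
join-== {m = m} (inj₂ i) (inj₂ j) = ==-injective (↑ʳ-injective m _ _) i j
join-==         (inj₁ i) (inj₂ j) = ==-≢ (↑ˡ≢↑ʳ i j)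
join-==         (inj₂ i) (inj₁ j) = ==-≢ (↑ˡ≢↑ʳ j i ∘ sym)

==-splitAt : ∀ m {n} (u v : Fin (m + n)) → (u == v) ≡ (splitAt m u ==⊎ splitAt m v)
==-splitAt m {n} u v = begin
  u == v
    ≡⟨ cong₂ _==_ (join-splitAt m n u) (join-splitAt m n v) ⟨
  join m n (splitAt m u) == join m n (splitAt m v)
    ≡⟨ join-== (splitAt m u) (splitAt m v) ⟩
  splitAt m u ==⊎ splitAt m v ∎
  where open ≡-Reasoning

relabel : Fin k → Fin k → Fin k → Fin k
relabel a b l = if l == a then b else l

relabel-fresh : {a b l : Fin k} → l ≢ a → relabel a b l ≡ l
relabel-fresh l≢a rewrite ==-≢ l≢a = refl

relabel-injective : {f : Fin k → Fin n} → Injective _≡_ _≡_ f →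
  ∀ a b l → relabel (f a) (f b) (f l) ≡ f (relabel a b l)
relabel-injective {f = f} f-inj a b l rewrite ==-injective f-inj l a = sym (if-float f (l == a))

relabel-≢ : {a b : Fin k} → a ≢ b → ∀ l → relabel a b l ≢ a
relabel-≢ {a = a} {b} a≢b l with l ≟ a
... | yes _   = a≢b ∘ sym
... | no l≢a  = l≢a

switch-involutive : ∀ (G : Graph n) x u v → adj (switch (switch G x) x) u v ≡ adj G u v
switch-involutive G x u v = begin
  (adj G u v xor d) xor d ≡⟨ xor-assoc (adj G u v) d d ⟩
  adj G u v xor (d xor d) ≡⟨ cong (adj G u v xor_) (xor-same d) ⟩
  adj G u v xor false     ≡⟨ xor-identityʳ (adj G u v) ⟩
  adj G u v               ∎
  where
  open ≡-Reasoning
  d = isX x u xor isX x v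

isX-↔ : ∀ (f : Fin n ↔ Fin m) x u → isX x u ≡ isX (Inverse.to f x) (Inverse.to f u)
isX-↔ f x u = sym (==-injective (Injection.injective (↔⇒↣ f)) u x)

switch-away : ∀ (G : Graph n) {x u v} → u ≢ x → v ≢ x → adj (switch G x) u v ≡ adj G u v
switch-away G {u = u} {v} u≢x v≢x =
  trans (cong₂ (λ a b → adj G u v xor (a xor b)) (==-≢ u≢x) (==-≢ v≢x))
        (xor-identityʳ (adj G u v))

switch-at : ∀ (G : Graph n) {x u} → u ≢ x → adj (switch G x) x u ≡ not (adj G x u)
switch-at G {x} {u} u≢x =
  trans (cong₂ (λ a b → adj G x u xor (a xor b)) (==-≡ {a = x} refl) (==-≢ u≢x))
        (xor-comm (adj G x u) true)

extendRel : (Fin k → Fin k → Bool) → (Fin k → Bool) → (Fin k → Bool) →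
            Fin (suc k) → Fin (suc k) → Bool
extendRel S row col zero    zero    = false
extendRel S row col zero    (suc j) = row j
extendRel S row col (suc i) zero    = col i
extendRel S row col (suc i) (suc j) = S i j

shiftLabels : NLCExpr k m → NLCExpr (suc k) m
shiftLabels (nlc-vtx a)      = nlc-vtx (suc a)
shiftLabels (nlc-join S s t) =
  nlc-join (extendRel S (const false) (const false)) (shiftLabels s) (shiftLabels t)
shiftLabels (nlc-relab R t)  = nlc-relab (lift 1 R) (shiftLabels t)

nlcLabel-shiftLabels : ∀ (t : NLCExpr k m) u → nlcLabel (shiftLabels t) u ≡ suc (nlcLabel t u)
nlcLabel-shiftLabels (nlc-vtx a)            u = refl
nlcLabel-shiftLabels (nlc-join {m} S s t)   u with splitAt m u
... | inj₁ u₁ = nlcLabel-shiftLabels s u₁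
... | inj₂ u₂ = nlcLabel-shiftLabels t u₂
nlcLabel-shiftLabels (nlc-relab R t)        u = cong (lift 1 R) (nlcLabel-shiftLabels t u)

nlcEdge-shiftLabels : ∀ (t : NLCExpr k m) u v → nlcEdge (shiftLabels t) u v ≡ nlcEdge t u v
nlcEdge-shiftLabels (nlc-vtx a)          u v = refl
nlcEdge-shiftLabels (nlc-join {m} S s t) u v with splitAt m u | splitAt m v
... | inj₁ u₁ | inj₁ v₁ = nlcEdge-shiftLabels s u₁ v₁
... | inj₂ u₂ | inj₂ v₂ = nlcEdge-shiftLabels t u₂ v₂
... | inj₁ u₁ | inj₂ v₂ =
  cong₂ (extendRel S _ _) (nlcLabel-shiftLabels s u₁) (nlcLabel-shiftLabels t v₂)
... | inj₂ u₂ | inj₁ v₁ =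
  cong₂ (extendRel S _ _) (nlcLabel-shiftLabels s v₁) (nlcLabel-shiftLabels t u₂)
nlcEdge-shiftLabels (nlc-relab R t)      u v = nlcEdge-shiftLabels t u v

switchAt : NLCExpr k m → Fin m → NLCExpr (suc k) m
switchAt (nlc-vtx _)          _ = nlc-vtx zero
switchAt (nlc-join {m} S s t) p with splitAt m p
... | inj₁ p₁ =
  nlc-join (extendRel S (not ∘ S (nlcLabel s p₁)) (const false)) (switchAt s p₁) (shiftLabels t)
... | inj₂ p₂ =
  nlc-join (extendRel S (const false) (λ i → not (S i (nlcLabel t p₂)))) (shiftLabels s) (switchAt t p₂)
switchAt (nlc-relab R t)      p = nlc-relab (lift 1 R) (switchAt t p)

nlcLabel-switchAt : ∀ (t : NLCExpr k m) p u →
  nlcLabel (switchAt t p) u ≡ (if isX p u then zero else suc (nlcLabel t u))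
nlcLabel-switchAt (nlc-vtx a) zero zero = refl
nlcLabel-switchAt (nlc-join {m} S s t) p u rewrite ==-splitAt m u p with splitAt m p
... | inj₁ p₁ with splitAt m u
...   | inj₁ u₁ = nlcLabel-switchAt s p₁ u₁
...   | inj₂ u₂ = nlcLabel-shiftLabels t u₂
nlcLabel-switchAt (nlc-join {m} S s t) p u | inj₂ p₂ with splitAt m u
...   | inj₁ u₁ = nlcLabel-shiftLabels s u₁
...   | inj₂ u₂ = nlcLabel-switchAt t p₂ u₂
nlcLabel-switchAt (nlc-relab R t) p u =
  trans (cong (lift 1 R) (nlcLabel-switchAt t p u)) (if-float (lift 1 R) (isX p u))

switchedRow : ∀ S (L : Fin m → Fin k) p u j →
  extendRel S (not ∘ S (L p)) (const false) (if isX p u then zero else suc (L u)) (suc j)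
    ≡ S (L u) j xor isX p u
switchedRow S L p u j with u ≟ p
... | yes refl = xor-comm true (S (L p) j)
... | no _     = sym (xor-identityʳ (S (L u) j))

switchedCol : ∀ S (L : Fin m → Fin k) p u i →
  extendRel S (const false) (λ i → not (S i (L p))) (suc i) (if isX p u then zero else suc (L u))
    ≡ S i (L u) xor isX p u
switchedCol S L p u i with u ≟ p
... | yes refl = xor-comm true (S i (L p))
... | no _     = sym (xor-identityʳ (S i (L u)))

nlcEdge-switchAt : ∀ (t : NLCExpr k m) p u v →
  nlcEdge (switchAt t p) u v ≡ nlcEdge t u v xor (isX p u xor isX p v)
nlcEdge-switchAt (nlc-vtx a) zero zero zero = refl
nlcEdge-switchAt (nlc-join {m} S s t) p u v
  rewrite ==-splitAt m u p | ==-splitAt m v p with splitAt m p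
... | inj₁ p₁ with splitAt m u | splitAt m v
...   | inj₁ u₁ | inj₁ v₁ = nlcEdge-switchAt s p₁ u₁ v₁
...   | inj₁ u₁ | inj₂ v₂
  rewrite nlcLabel-switchAt s p₁ u₁ | nlcLabel-shiftLabels t v₂ | xor-identityʳ (isX p₁ u₁)
  = switchedRow S (nlcLabel s) p₁ u₁ (nlcLabel t v₂)
...   | inj₂ u₂ | inj₁ v₁
  rewrite nlcLabel-switchAt s p₁ v₁ | nlcLabel-shiftLabels t u₂
  = switchedRow S (nlcLabel s) p₁ v₁ (nlcLabel t u₂)
...   | inj₂ u₂ | inj₂ v₂ = trans (nlcEdge-shiftLabels t u₂ v₂) (sym (xor-identityʳ _))
nlcEdge-switchAt (nlc-join {m} S s t) p u v | inj₂ p₂ with splitAt m u | splitAt m v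
...   | inj₁ u₁ | inj₁ v₁ = trans (nlcEdge-shiftLabels s u₁ v₁) (sym (xor-identityʳ _))
...   | inj₁ u₁ | inj₂ v₂
  rewrite nlcLabel-switchAt t p₂ v₂ | nlcLabel-shiftLabels s u₁
  = switchedCol S (nlcLabel t) p₂ v₂ (nlcLabel s u₁)
...   | inj₂ u₂ | inj₁ v₁
  rewrite nlcLabel-switchAt t p₂ u₂ | nlcLabel-shiftLabels s v₁ | xor-identityʳ (isX p₂ u₂)
  = switchedCol S (nlcLabel t) p₂ u₂ (nlcLabel s v₁)
...   | inj₂ u₂ | inj₂ v₂ = nlcEdge-switchAt t p₂ u₂ v₂
nlcEdge-switchAt (nlc-relab R t) p u v = nlcEdge-switchAt t p u v

InNLC-switch : ∀ (G : Graph n) x → InNLC G k → InNLC (switch G x) (suc k)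
InNLC-switch G x (m , t , f , t≅G) = m , switchAt t (to x) , f , λ u v → begin
  adj G u v xor (isX x u xor isX x v)
    ≡⟨ cong₂ _xor_ (t≅G u v) (cong₂ _xor_ (isX-↔ f x u) (isX-↔ f x v)) ⟩
  nlcEdge t (to u) (to v) xor (isX (to x) (to u) xor isX (to x) (to v))
    ≡⟨ sym (nlcEdge-switchAt t (to x) (to u) (to v)) ⟩
  nlcEdge (switchAt t (to x)) (to u) (to v) ∎
  where
  open ≡-Reasoning
  open Inverse f using (to)

Linked : (a b l l′ : Fin k) → Set
Linked a b l l′ = (l ≡ a × l′ ≡ b) ⊎ (l ≡ b × l′ ≡ a)

linked? : (a b l l′ : Fin k) → Dec (Linked a b l l′)
linked? a b l l′ = (l ≟ a ×-dec l′ ≟ b) ⊎-dec (l ≟ b ×-dec l′ ≟ a)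

Linked-swap : {a b l l′ : Fin k} → Linked a b l l′ → Linked a b l′ l
Linked-swap (inj₁ (l≡a , l′≡b)) = inj₂ (l′≡b , l≡a)
Linked-swap (inj₂ (l≡b , l′≡a)) = inj₁ (l′≡a , l≡b)

Linked-diag : {a b l : Fin k} → Linked a b l l → a ≡ b
Linked-diag (inj₁ (l≡a , l≡b)) = trans (sym l≡a) l≡b
Linked-diag (inj₂ (l≡b , l≡a)) = trans (sym l≡a) l≡b

cwEdge-join : ∀ a b (a≢b : a ≢ b) (E : CWExpr k m) u v →
  cwEdge (cw-join a b a≢b E) u v ≡ cwEdge E u v ∨ does (linked? a b (cwLabel E u) (cwLabel E v))
cwEdge-join a b _ E u v = cong (cwEdge E u v ∨_) (cong₂ _∨_
  (cong₂ _∧_ (isYes≗does (l ≟ a)) (isYes≗does (l′ ≟ b)))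
  (cong₂ _∧_ (isYes≗does (l ≟ b)) (isYes≗does (l′ ≟ a))))
  where
  l  = cwLabel E u
  l′ = cwLabel E v

cwEdge-sym : ∀ (E : CWExpr k m) u v → cwEdge E u v ≡ cwEdge E v u
cwEdge-sym (cw-vtx _)             u v = refl
cwEdge-sym (cw-union {a} s t)     u v with splitAt a u | splitAt a v
... | inj₁ u₁ | inj₁ v₁ = cwEdge-sym s u₁ v₁
... | inj₁ _  | inj₂ _  = refl
... | inj₂ _  | inj₁ _  = refl
... | inj₂ u₂ | inj₂ v₂ = cwEdge-sym t u₂ v₂
cwEdge-sym (cw-relab _ _ _ E)     u v = cwEdge-sym E u v
cwEdge-sym (cw-join a b a≢b E)    u v
  rewrite cwEdge-join a b a≢b E u v | cwEdge-join a b a≢b E v u =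
  cong₂ _∨_ (cwEdge-sym E u v)
    (does-⇔ (mk⇔ Linked-swap Linked-swap) (linked? a b (cwLabel E u) (cwLabel E v)) (linked? a b _ _))

cwEdge-irrefl : ∀ (E : CWExpr k m) u → cwEdge E u u ≡ false
cwEdge-irrefl (cw-vtx _)          u = refl
cwEdge-irrefl (cw-union {a} s t)  u with splitAt a u
... | inj₁ u₁ = cwEdge-irrefl s u₁
... | inj₂ u₂ = cwEdge-irrefl t u₂
cwEdge-irrefl (cw-relab _ _ _ E)  u = cwEdge-irrefl E u
cwEdge-irrefl (cw-join a b a≢b E) u = trans (cwEdge-join a b a≢b E u u) (cong₂ _∨_
  (cwEdge-irrefl E u) (dec-false (linked? a b (cwLabel E u) (cwLabel E u)) (a≢b ∘ Linked-diag)))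

CWExpr₀-empty : CWExpr 0 m → ⊥
CWExpr₀-empty (cw-vtx ())
CWExpr₀-empty (cw-union s _)     = CWExpr₀-empty s
CWExpr₀-empty (cw-relab _ _ _ E) = CWExpr₀-empty E
CWExpr₀-empty (cw-join _ _ _ E)  = CWExpr₀-empty E

cwEdge-oneLabel : k ≡ 1 → ∀ (E : CWExpr k m) u v → cwEdge E u v ≡ false
cwEdge-oneLabel refl (cw-vtx _)                 u v = refl
cwEdge-oneLabel refl (cw-union {a} s t)         u v with splitAt a u | splitAt a v
... | inj₁ u₁ | inj₁ v₁ = cwEdge-oneLabel refl s u₁ v₁
... | inj₁ _  | inj₂ _  = refl
... | inj₂ _  | inj₁ _  = refl
... | inj₂ u₂ | inj₂ v₂ = cwEdge-oneLabel refl t u₂ v₂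
cwEdge-oneLabel refl (cw-relab zero zero 0≢0 _) u v = ⊥-elim (0≢0 refl)
cwEdge-oneLabel refl (cw-join zero zero 0≢0 _)  u v = ⊥-elim (0≢0 refl)

⊎-map-injective : {f : Fin m → Fin m′} {g : Fin n → Fin n′} →
  Injective _≡_ _≡_ f → Injective _≡_ _≡_ g → Injective _≡_ _≡_ (Sum.map f g)
⊎-map-injective f-inj g-inj {inj₁ _} {inj₁ _} eq = cong inj₁ (f-inj (inj₁-injective eq))
⊎-map-injective f-inj g-inj {inj₂ _} {inj₂ _} eq = cong inj₂ (g-inj (inj₂-injective eq))

unionMap : (Fin m′ → Fin m) → (Fin n′ → Fin n) → Fin (m′ + n′) → Fin (m + n)
unionMap {m′} {m} {n′} {n} f g = join m n ∘ Sum.map f g ∘ splitAt m′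

splitAt-unionMap : ∀ (f : Fin m′ → Fin m) (g : Fin n′ → Fin n) i →
  splitAt m (unionMap f g i) ≡ Sum.map f g (splitAt m′ i)
splitAt-unionMap {m = m} {n = n} f g i = splitAt-join m n _

unionMap-↑ˡ : ∀ (f : Fin m′ → Fin m) (g : Fin n′ → Fin n) i → unionMap f g (i ↑ˡ n′) ≡ f i ↑ˡ n
unionMap-↑ˡ {m′} {m} {n′} {n} f g i = cong (join m n ∘ Sum.map f g) (splitAt-↑ˡ m′ i n′)

unionMap-↑ʳ : ∀ (f : Fin m′ → Fin m) (g : Fin n′ → Fin n) j → unionMap f g (m′ ↑ʳ j) ≡ m ↑ʳ g j
unionMap-↑ʳ {m′} {m} {n′} {n} f g j = cong (join m n ∘ Sum.map f g) (splitAt-↑ʳ m′ n′ j)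

record Embedding (E′ : CWExpr k m′) (E : CWExpr k m) : Set where
  field
    vertex    : Fin m′ → Fin m
    injective : Injective _≡_ _≡_ vertex
    label     : ∀ i → cwLabel E (vertex i) ≡ cwLabel E′ i
    edge      : ∀ i j → cwEdge E (vertex i) (vertex j) ≡ cwEdge E′ i j

open Embedding

Embedding-refl : (E : CWExpr k m) → Embedding E E
Embedding-refl E = record { vertex = id ; injective = id ; label = λ _ → refl ; edge = λ _ _ → refl }

Embedding-unionˡ : ∀ (s : CWExpr k m) (t : CWExpr k n) → Embedding s (cw-union s t)
Embedding-unionˡ {m = m} {n = n} s t = record
  { vertex = _↑ˡ n ; injective = ↑ˡ-injective n _ _ ; label = label′ ; edge = edge′ }
  where
  label′ : ∀ i → cwLabel (cw-union s t) (i ↑ˡ n) ≡ cwLabel s i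
  label′ i rewrite splitAt-↑ˡ m i n = refl
  edge′ : ∀ i j → cwEdge (cw-union s t) (i ↑ˡ n) (j ↑ˡ n) ≡ cwEdge s i j
  edge′ i j rewrite splitAt-↑ˡ m i n | splitAt-↑ˡ m j n = refl

Embedding-unionʳ : ∀ (s : CWExpr k m) (t : CWExpr k n) → Embedding t (cw-union s t)
Embedding-unionʳ {m = m} {n = n} s t = record
  { vertex = m ↑ʳ_ ; injective = ↑ʳ-injective m _ _ ; label = label′ ; edge = edge′ }
  where
  label′ : ∀ i → cwLabel (cw-union s t) (m ↑ʳ i) ≡ cwLabel t i
  label′ i rewrite splitAt-↑ʳ m n i = refl
  edge′ : ∀ i j → cwEdge (cw-union s t) (m ↑ʳ i) (m ↑ʳ j) ≡ cwEdge t i j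
  edge′ i j rewrite splitAt-↑ʳ m n i | splitAt-↑ʳ m n j = refl

Embedding-union : {s : CWExpr k m} {s′ : CWExpr k m′} {t : CWExpr k n} {t′ : CWExpr k n′} →
  Embedding s′ s → Embedding t′ t → Embedding (cw-union s′ t′) (cw-union s t)
Embedding-union {m = m} {m′ = m′} {n = n} {n′ = n′} {s = s} {s′} {t} {t′} ι κ = record
  { vertex    = vertex′
  ; injective = Injection.injective (↔⇒↣ +↔⊎) ∘ ⊎-map-injective (injective ι) (injective κ) ∘
                Injection.injective (↔⇒↣ (↔-sym +↔⊎))
  ; label     = label′
  ; edge      = edge′
  }
  where
  vertex′ : Fin (m′ + n′) → Fin (m + n)
  vertex′ = unionMap (vertex ι) (vertex κ)
  label′ : ∀ i → cwLabel (cw-union s t) (vertex′ i) ≡ cwLabel (cw-union s′ t′) i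
  label′ i with splitAt m′ i
  ... | inj₁ i₁ rewrite splitAt-↑ˡ m (vertex ι i₁) n = label ι i₁
  ... | inj₂ i₂ rewrite splitAt-↑ʳ m n (vertex κ i₂) = label κ i₂
  edge′ : ∀ i j → cwEdge (cw-union s t) (vertex′ i) (vertex′ j) ≡ cwEdge (cw-union s′ t′) i j
  edge′ i j with splitAt m′ i | splitAt m′ j
  ... | inj₁ i₁ | inj₁ j₁
    rewrite splitAt-↑ˡ m (vertex ι i₁) n | splitAt-↑ˡ m (vertex ι j₁) n = edge ι i₁ j₁
  ... | inj₁ i₁ | inj₂ j₂
    rewrite splitAt-↑ˡ m (vertex ι i₁) n | splitAt-↑ʳ m n (vertex κ j₂) = refl
  ... | inj₂ i₂ | inj₁ j₁
    rewrite splitAt-↑ʳ m n (vertex κ i₂) | splitAt-↑ˡ m (vertex ι j₁) n = refl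
  ... | inj₂ i₂ | inj₂ j₂
    rewrite splitAt-↑ʳ m n (vertex κ i₂) | splitAt-↑ʳ m n (vertex κ j₂) = edge κ i₂ j₂

Embedding-relab : ∀ a b (a≢b : a ≢ b) {E : CWExpr k m} {E′ : CWExpr k m′} →
  Embedding E′ E → Embedding (cw-relab a b a≢b E′) (cw-relab a b a≢b E)
Embedding-relab a b _ ι = record
  { vertex    = vertex ι
  ; injective = injective ι
  ; label     = λ i → cong (relabel a b) (label ι i)
  ; edge      = edge ι
  }

Embedding-join : ∀ a b (a≢b : a ≢ b) {E : CWExpr k m} {E′ : CWExpr k m′} →
  Embedding E′ E → Embedding (cw-join a b a≢b E′) (cw-join a b a≢b E)
Embedding-join a b _ ι = record
  { vertex    = vertex ι
  ; injective = injective ι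
  ; label     = label ι
  ; edge      = λ i j → cong₂ _∨_ (edge ι i j)
      (cong₂ (λ l l′ → (l == a) ∧ (l′ == b) ∨ (l == b) ∧ (l′ == a)) (label ι i) (label ι j))
  }

data VertexDeletion (E : CWExpr k m) (p : Fin m) : Set where
  sole : (∀ q → q ≡ p) → VertexDeletion E p
  rest : (E′ : CWExpr k m′) (ι : Embedding E′ E) → (∀ i → vertex ι i ≢ p) →
         (∀ q → q ≢ p → ∃ λ i → vertex ι i ≡ q) → VertexDeletion E p

deleteˡ : ∀ (s : CWExpr k m) (t : CWExpr k n) {p} →
  VertexDeletion s p → VertexDeletion (cw-union s t) (p ↑ˡ n)
deleteˡ {m = m} {n = n} s t {p} (sole only-p) =
  rest t (Embedding-unionʳ s t) (λ i → ↑ˡ≢↑ʳ p i ∘ sym) onto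
  where
  onto : ∀ q → q ≢ p ↑ˡ n → ∃ λ i → m ↑ʳ i ≡ q
  onto q q≢p with splitAt m q in eq
  ... | inj₁ q₁ with refl ← splitAt⁻¹-↑ˡ eq = ⊥-elim (q≢p (cong (_↑ˡ n) (only-p q₁)))
  ... | inj₂ q₂ = q₂ , splitAt⁻¹-↑ʳ eq
deleteˡ {m = m} {n = n} s t {p} (rest {m′} s′ ι ι≢p onto) =
  rest (cw-union s′ t) (Embedding-union ι (Embedding-refl t)) miss onto′
  where
  μ = unionMap (vertex ι) id
  miss : ∀ i → μ i ≢ p ↑ˡ n
  miss i eq with splitAt m′ i
               | trans (sym (splitAt-unionMap (vertex ι) id i)) (trans (cong (splitAt m) eq) (splitAt-↑ˡ m p n))
  ... | inj₁ i₁ | e = ι≢p i₁ (inj₁-injective e)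
  onto′ : ∀ q → q ≢ p ↑ˡ n → ∃ λ i → μ i ≡ q
  onto′ q q≢p with splitAt m q in eq
  ... | inj₁ q₁ with refl ← splitAt⁻¹-↑ˡ eq with onto q₁ (q≢p ∘ cong (_↑ˡ n))
  ...   | i₁ , ιi₁≡q₁ = i₁ ↑ˡ n , trans (unionMap-↑ˡ (vertex ι) id i₁) (cong (_↑ˡ n) ιi₁≡q₁)
  onto′ q q≢p | inj₂ q₂ = m′ ↑ʳ q₂ , trans (unionMap-↑ʳ (vertex ι) id q₂) (splitAt⁻¹-↑ʳ eq)

deleteʳ : ∀ (s : CWExpr k m) (t : CWExpr k n) {p} →
  VertexDeletion t p → VertexDeletion (cw-union s t) (m ↑ʳ p)
deleteʳ {m = m} {n = n} s t {p} (sole only-p) =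
  rest s (Embedding-unionˡ s t) (λ i → ↑ˡ≢↑ʳ i p) onto
  where
  onto : ∀ q → q ≢ m ↑ʳ p → ∃ λ i → i ↑ˡ n ≡ q
  onto q q≢p with splitAt m q in eq
  ... | inj₁ q₁ = q₁ , splitAt⁻¹-↑ˡ eq
  ... | inj₂ q₂ with refl ← splitAt⁻¹-↑ʳ eq = ⊥-elim (q≢p (cong (m ↑ʳ_) (only-p q₂)))
deleteʳ {m = m} {n = n} s t {p} (rest {n′} t′ ι ι≢p onto) =
  rest (cw-union s t′) (Embedding-union (Embedding-refl s) ι) miss onto′
  where
  μ = unionMap id (vertex ι)
  miss : ∀ i → μ i ≢ m ↑ʳ p
  miss i eq with splitAt m i
               | trans (sym (splitAt-unionMap id (vertex ι) i)) (trans (cong (splitAt m) eq) (splitAt-↑ʳ m n p))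
  ... | inj₂ i₂ | e = ι≢p i₂ (inj₂-injective e)
  onto′ : ∀ q → q ≢ m ↑ʳ p → ∃ λ i → μ i ≡ q
  onto′ q q≢p with splitAt m q in eq
  ... | inj₁ q₁ = q₁ ↑ˡ n′ , trans (unionMap-↑ˡ id (vertex ι) q₁) (splitAt⁻¹-↑ˡ eq)
  ... | inj₂ q₂ with refl ← splitAt⁻¹-↑ʳ eq with onto q₂ (q≢p ∘ cong (m ↑ʳ_))
  ...   | i₂ , ιi₂≡q₂ = m ↑ʳ i₂ , trans (unionMap-↑ʳ id (vertex ι) i₂) (cong (m ↑ʳ_) ιi₂≡q₂)

Fin1-unique : ∀ (q p : Fin 1) → q ≡ p
Fin1-unique zero zero = refl

deleteVertex : ∀ (E : CWExpr k m) p → VertexDeletion E p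
deleteVertex (cw-vtx _)            p = sole (λ q → Fin1-unique q p)
deleteVertex (cw-union {m} s t)    p with splitAt m p in eq
... | inj₁ p₁ = subst (VertexDeletion _) (splitAt⁻¹-↑ˡ eq) (deleteˡ s t (deleteVertex s p₁))
... | inj₂ p₂ = subst (VertexDeletion _) (splitAt⁻¹-↑ʳ eq) (deleteʳ s t (deleteVertex t p₂))
deleteVertex (cw-relab a b a≢b E)  p with deleteVertex E p
... | sole only-p           = sole only-p
... | rest E′ ι ι≢p onto    = rest (cw-relab a b a≢b E′) (Embedding-relab a b a≢b ι) ι≢p onto
deleteVertex (cw-join a b a≢b E)   p with deleteVertex E p
... | sole only-p           = sole only-p
... | rest E′ ι ι≢p onto    = rest (cw-join a b a≢b E′) (Embedding-join a b a≢b ι) ι≢p onto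

complement↔ : {ι : Fin m′ → Fin m} {p : Fin m} → Injective _≡_ _≡_ ι → (∀ i → ι i ≢ p) →
  (∀ q → q ≢ p → ∃ λ i → ι i ≡ q) → Fin m ↔ Fin (suc m′)
complement↔ {m′ = m′} {m} {ι} {p} ι-inj ι≢p onto = mk↔ₛ′ to from to∘from from∘to
  where
  from : Fin (suc m′) → Fin m
  from zero    = p
  from (suc i) = ι i
  to : Fin m → Fin (suc m′)
  to q with q ≟ p
  ... | yes _   = zero
  ... | no q≢p  = suc (proj₁ (onto q q≢p))
  to∘from : ∀ i → to (from i) ≡ i
  to∘from zero with p ≟ p
  ... | yes _   = refl
  ... | no p≢p  = ⊥-elim (p≢p refl)
  to∘from (suc i) with ι i ≟ p
  ... | yes ιi≡p = ⊥-elim (ι≢p i ιi≡p)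
  ... | no ιi≢p  = cong suc (ι-inj (proj₂ (onto (ι i) ιi≢p)))
  from∘to : ∀ q → from (to q) ≡ q
  from∘to q with q ≟ p
  ... | yes q≡p = sym q≡p
  ... | no q≢p  = proj₂ (onto q q≢p)

bit : Bool → Fin 2
bit false = zero
bit true  = suc zero

bit-injective : Injective _≡_ _≡_ bit
bit-injective {false} {false} _ = refl
bit-injective {true}  {true}  _ = refl

tag : Bool → Fin k → Fin (2 * k)
tag f = combine (bit f)

tag-injective : ∀ f g {i j : Fin k} → tag f i ≡ tag g j → f ≡ g × i ≡ j
tag-injective {k} f g {i} {j} eq with ,-injective (begin
  (bit f , i)               ≡⟨ remQuot-combine (bit f) i ⟨
  remQuot k (tag f i)       ≡⟨ cong (remQuot k) eq ⟩
  remQuot k (tag g j)       ≡⟨ remQuot-combine (bit g) j ⟩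
  (bit g , j)               ∎)
  where open ≡-Reasoning
... | bf≡bg , i≡j = bit-injective bf≡bg , i≡j

tag-injectiveʳ : ∀ f g {i j : Fin k} → tag f i ≡ tag g j → i ≡ j
tag-injectiveʳ f g = proj₂ ∘ tag-injective f g

tag-≢ : ∀ f g {i j : Fin k} → i ≢ j → tag f i ≢ tag g j
tag-≢ f g i≢j = i≢j ∘ tag-injectiveʳ f g

tag-flag-≢ : ∀ (i j : Fin k) → tag true i ≢ tag false j
tag-flag-≢ i j eq with () ← proj₁ (tag-injective true false eq)

joinTags : (a b : Fin k) → a ≢ b → CWExpr (2 * k) m → CWExpr (2 * k) m
joinTags a b a≢b =
  cw-join (tag false a) (tag false b) (tag-≢ false false a≢b) ∘
  cw-join (tag false a) (tag true b)  (tag-≢ false true a≢b) ∘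
  cw-join (tag true a)  (tag false b) (tag-≢ true false a≢b) ∘
  cw-join (tag true a)  (tag true b)  (tag-≢ true true a≢b)

double : CWExpr k m → (Fin m → Bool) → CWExpr (2 * k) m
double (cw-vtx a)               φ = cw-vtx (tag (φ zero) a)
double (cw-union {m} {n} s t)   φ = cw-union (double s (φ ∘ (_↑ˡ n))) (double t (φ ∘ (m ↑ʳ_)))
double (cw-relab a b a≢b E)     φ =
  cw-relab (tag false a) (tag false b) (tag-≢ false false a≢b)
    (cw-relab (tag true a) (tag true b) (tag-≢ true true a≢b) (double E φ))
double (cw-join a b a≢b E)      φ = joinTags a b a≢b (double E φ)

relabel-tags : ∀ (a b : Fin k) f l →
  relabel (tag false a) (tag false b) (relabel (tag true a) (tag true b) (tag f l)) ≡ tag f (relabel a b l)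
relabel-tags a b true  l = begin
  relabel (tag false a) (tag false b) (relabel (tag true a) (tag true b) (tag true l))
    ≡⟨ cong (relabel (tag false a) (tag false b))
            (relabel-injective (tag-injectiveʳ true true) a b l) ⟩
  relabel (tag false a) (tag false b) (tag true (relabel a b l))
    ≡⟨ relabel-fresh {a = tag false a} {tag false b} {tag true (relabel a b l)} (tag-flag-≢ _ a) ⟩
  tag true (relabel a b l) ∎
  where open ≡-Reasoning
relabel-tags a b false l = begin
  relabel (tag false a) (tag false b) (relabel (tag true a) (tag true b) (tag false l))
    ≡⟨ cong (relabel (tag false a) (tag false b))
            (relabel-fresh {a = tag true a} {tag true b} {tag false l} (tag-flag-≢ a l ∘ sym)) ⟩
  relabel (tag false a) (tag false b) (tag false l)
    ≡⟨ relabel-injective (tag-injectiveʳ false false) a b l ⟩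
  tag false (relabel a b l) ∎
  where open ≡-Reasoning

cwLabel-double : ∀ (E : CWExpr k m) φ u → cwLabel (double E φ) u ≡ tag (φ u) (cwLabel E u)
cwLabel-double (cw-vtx a)             φ zero = refl
cwLabel-double (cw-union {m} {n} s t) φ u with splitAt m u in eq
... | inj₁ u₁ with refl ← splitAt⁻¹-↑ˡ eq = cwLabel-double s _ u₁
... | inj₂ u₂ with refl ← splitAt⁻¹-↑ʳ eq = cwLabel-double t _ u₂
cwLabel-double (cw-relab a b _ E)     φ u
  rewrite cwLabel-double E φ u = relabel-tags a b (φ u) (cwLabel E u)
cwLabel-double (cw-join _ _ _ E)      φ u = cwLabel-double E φ u

LinkedTags : (a b : Fin k) (L L′ : Fin (2 * k)) → Set
LinkedTags a b L L′ =
  Linked (tag true a) (tag true b) L L′ ⊎ Linked (tag true a) (tag false b) L L′ ⊎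
  Linked (tag false a) (tag true b) L L′ ⊎ Linked (tag false a) (tag false b) L L′

linkedTags? : (a b : Fin k) (L L′ : Fin (2 * k)) → Dec (LinkedTags a b L L′)
linkedTags? a b L L′ =
  linked? (tag true a) (tag true b) L L′ ⊎-dec linked? (tag true a) (tag false b) L L′ ⊎-dec
  linked? (tag false a) (tag true b) L L′ ⊎-dec linked? (tag false a) (tag false b) L L′

cwEdge-joinTags : ∀ (a b : Fin k) (a≢b : a ≢ b) (D : CWExpr (2 * k) m) u v →
  cwEdge (joinTags a b a≢b D) u v ≡ cwEdge D u v ∨ does (linkedTags? a b (cwLabel D u) (cwLabel D v))
cwEdge-joinTags {k} {m} a b a≢b D u v = begin
  cwEdge (joinTags a b a≢b D) u v
    ≡⟨ cwEdge-join (tag false a) (tag false b) (tag-≢ false false a≢b) (J₃ D) u v ⟩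
  cwEdge (J₃ D) u v ∨ d₄
    ≡⟨ cong (_∨ d₄) (cwEdge-join (tag false a) (tag true b) (tag-≢ false true a≢b) (J₂ D) u v) ⟩
  (cwEdge (J₂ D) u v ∨ d₃) ∨ d₄
    ≡⟨ cong (λ e → (e ∨ d₃) ∨ d₄) (cwEdge-join (tag true a) (tag false b) (tag-≢ true false a≢b) (J₁ D) u v) ⟩
  ((cwEdge (J₁ D) u v ∨ d₂) ∨ d₃) ∨ d₄
    ≡⟨ cong (λ e → ((e ∨ d₂) ∨ d₃) ∨ d₄) (cwEdge-join (tag true a) (tag true b) (tag-≢ true true a≢b) D u v) ⟩
  (((e ∨ d₁) ∨ d₂) ∨ d₃) ∨ d₄
    ≡⟨ ∨-assoc ((e ∨ d₁) ∨ d₂) d₃ d₄ ⟩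
  ((e ∨ d₁) ∨ d₂) ∨ (d₃ ∨ d₄)
    ≡⟨ ∨-assoc (e ∨ d₁) d₂ (d₃ ∨ d₄) ⟩
  (e ∨ d₁) ∨ (d₂ ∨ d₃ ∨ d₄)
    ≡⟨ ∨-assoc e d₁ (d₂ ∨ d₃ ∨ d₄) ⟩
  e ∨ (d₁ ∨ d₂ ∨ d₃ ∨ d₄) ∎
  where
  open ≡-Reasoning
  e  = cwEdge D u v
  L  = cwLabel D u
  L′ = cwLabel D v
  J₁ J₂ J₃ : CWExpr (2 * k) m → CWExpr (2 * k) m
  J₁ = cw-join (tag true a) (tag true b) (tag-≢ true true a≢b)
  J₂ = cw-join (tag true a) (tag false b) (tag-≢ true false a≢b) ∘ J₁
  J₃ = cw-join (tag false a) (tag true b) (tag-≢ false true a≢b) ∘ J₂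
  d₁ = does (linked? (tag true a) (tag true b) L L′)
  d₂ = does (linked? (tag true a) (tag false b) L L′)
  d₃ = does (linked? (tag false a) (tag true b) L L′)
  d₄ = does (linked? (tag false a) (tag false b) L L′)

LinkedTags⇔Linked : ∀ (a b l l′ : Fin k) f g {L L′} →
  L ≡ tag f l → L′ ≡ tag g l′ → LinkedTags a b L L′ ⇔ Linked a b l l′
LinkedTags⇔Linked {k} a b l l′ f g refl refl = mk⇔
  [ untag true true , [ untag true false , [ untag false true , untag false false ]′ ]′ ]′
  retag
  where
  untag : ∀ X Y → Linked (tag X a) (tag Y b) (tag f l) (tag g l′) → Linked a b l l′
  untag X Y = Sum.map (Product.map (tag-injectiveʳ f X) (tag-injectiveʳ g Y))
                      (Product.map (tag-injectiveʳ f Y) (tag-injectiveʳ g X))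
  pick : ∀ X Y → Linked (tag X a) (tag Y b) (tag f l) (tag g l′) →
         LinkedTags a b (tag f l) (tag g l′)
  pick true  true  = inj₁
  pick true  false = inj₂ ∘ inj₁
  pick false true  = inj₂ ∘ inj₂ ∘ inj₁
  pick false false = inj₂ ∘ inj₂ ∘ inj₂
  retag : Linked a b l l′ → LinkedTags a b (tag f l) (tag g l′)
  retag (inj₁ (refl , refl)) = pick f g (inj₁ (refl , refl))
  retag (inj₂ (refl , refl)) = pick g f (inj₂ (refl , refl))

cwEdge-double : ∀ (E : CWExpr k m) φ u v → cwEdge (double E φ) u v ≡ cwEdge E u v
cwEdge-double (cw-vtx _)             φ u v = refl
cwEdge-double (cw-union {m} s t)     φ u v with splitAt m u | splitAt m v
... | inj₁ u₁ | inj₁ v₁ = cwEdge-double s _ u₁ v₁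
... | inj₁ _  | inj₂ _  = refl
... | inj₂ _  | inj₁ _  = refl
... | inj₂ u₂ | inj₂ v₂ = cwEdge-double t _ u₂ v₂
cwEdge-double (cw-relab _ _ _ E)     φ u v = cwEdge-double E φ u v
cwEdge-double (cw-join a b a≢b E)    φ u v = begin
  cwEdge (joinTags a b a≢b D) u v
    ≡⟨ cwEdge-joinTags a b a≢b D u v ⟩
  cwEdge D u v ∨ does (linkedTags? a b (cwLabel D u) (cwLabel D v))
    ≡⟨ cong₂ _∨_ (cwEdge-double E φ u v) (does-⇔
        (LinkedTags⇔Linked a b (cwLabel E u) (cwLabel E v) (φ u) (φ v)
          (cwLabel-double E φ u) (cwLabel-double E φ v))
        (linkedTags? a b (cwLabel D u) (cwLabel D v)) (linked? a b (cwLabel E u) (cwLabel E v))) ⟩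
  cwEdge E u v ∨ does (linked? a b (cwLabel E u) (cwLabel E v))
    ≡⟨ cwEdge-join a b a≢b E u v ⟨
  cwEdge (cw-join a b a≢b E) u v ∎
  where
  open ≡-Reasoning
  D = double E φ


InCW-double : ∀ (G : Graph n) → InCW G k → InCW G (2 * k)
InCW-double G (m , E , f , E≅G) =
  m , double E (const false) , f , λ u v → trans (E≅G u v) (sym (cwEdge-double E (const false) _ _))

linkApex : Fin k → List (Fin k) → CWExpr (2 * k) m → CWExpr (2 * k) m
linkApex c []       F = F
linkApex c (j ∷ js) F = linkApex c js (cw-join (tag false c) (tag true j) (tag-flag-≢ j c ∘ sym) F)

cwLabel-linkApex : ∀ (c : Fin k) js (F : CWExpr (2 * k) m) u → cwLabel (linkApex c js F) u ≡ cwLabel F u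
cwLabel-linkApex c []       F u = refl
cwLabel-linkApex c (j ∷ js) F u = cwLabel-linkApex c js _ u

linkedApex? : (c : Fin k) (L L′ : Fin (2 * k)) (js : List (Fin k)) →
  Dec (Any (λ j → Linked (tag false c) (tag true j) L L′) js)
linkedApex? c L L′ = any? (λ j → linked? (tag false c) (tag true j) L L′)

cwEdge-linkApex : ∀ (c : Fin k) js (F : CWExpr (2 * k) m) u v →
  cwEdge (linkApex c js F) u v ≡ cwEdge F u v ∨ does (linkedApex? c (cwLabel F u) (cwLabel F v) js)
cwEdge-linkApex c []       F u v = sym (∨-identityʳ (cwEdge F u v))
cwEdge-linkApex c (j ∷ js) F u v = begin
  cwEdge (linkApex c js F′) u v
    ≡⟨ cwEdge-linkApex c js F′ u v ⟩
  cwEdge F′ u v ∨ others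
    ≡⟨ cong (_∨ others) (cwEdge-join (tag false c) (tag true j) (tag-flag-≢ j c ∘ sym) F u v) ⟩
  (cwEdge F u v ∨ does (linked? (tag false c) (tag true j) (cwLabel F u) (cwLabel F v))) ∨ others
    ≡⟨ ∨-assoc (cwEdge F u v) _ others ⟩
  cwEdge F u v ∨ does (linkedApex? c (cwLabel F u) (cwLabel F v) (j ∷ js)) ∎
  where
  open ≡-Reasoning
  F′ = cw-join (tag false c) (tag true j) (tag-flag-≢ j c ∘ sym) F
  others = does (linkedApex? c (cwLabel F u) (cwLabel F v) js)

addApex : Fin k → CWExpr (2 * k) m → CWExpr (2 * k) (suc m)
addApex {k} c E = linkApex c (allFin k) (cw-union (cw-vtx (tag false c)) E)

cwEdge-addApex-suc : ∀ (c : Fin k) (E : CWExpr (2 * k) m) → (∀ i → cwLabel E i ≢ tag false c) →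
  ∀ i j → cwEdge (addApex c E) (suc i) (suc j) ≡ cwEdge E i j
cwEdge-addApex-suc {k} c E avoids i j = begin
  cwEdge (addApex c E) (suc i) (suc j)
    ≡⟨ cwEdge-linkApex c (allFin k) (cw-union (cw-vtx (tag false c)) E) (suc i) (suc j) ⟩
  cwEdge E i j ∨ does (linkedApex? c (cwLabel E i) (cwLabel E j) (allFin k))
    ≡⟨ cong (cwEdge E i j ∨_) (dec-false (linkedApex? c (cwLabel E i) (cwLabel E j) (allFin k))
                                          (λ any → unlinked (proj₂ (satisfied any)))) ⟩
  cwEdge E i j ∨ false
    ≡⟨ ∨-identityʳ (cwEdge E i j) ⟩
  cwEdge E i j ∎
  where
  open ≡-Reasoning
  unlinked : ∀ {j′ : Fin k} → ¬ Linked (tag false c) (tag true j′) (cwLabel E i) (cwLabel E j)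
  unlinked (inj₁ (i↦c , _)) = avoids i i↦c
  unlinked (inj₂ (_ , j↦c)) = avoids j j↦c

cwEdge-addApex-zero : ∀ (c : Fin k) (E : CWExpr (2 * k) m) j f (ℓ : Fin k) → cwLabel E j ≡ tag f ℓ →
  cwEdge (addApex c E) zero (suc j) ≡ f
cwEdge-addApex-zero {k} c E j f ℓ j↦fℓ = begin
  cwEdge (addApex c E) zero (suc j)
    ≡⟨ cwEdge-linkApex c (allFin k) (cw-union (cw-vtx (tag false c)) E) zero (suc j) ⟩
  does (linkedApex? c (tag false c) (cwLabel E j) (allFin k))
    ≡⟨ does-⇔ (mk⇔ linked⇒f f⇒linked) (linkedApex? c _ _ (allFin k)) (T? f) ⟩
  f ∎
  where
  open ≡-Reasoning
  linked⇒f : Any (λ j′ → Linked (tag false c) (tag true j′) (tag false c) (cwLabel E j)) (allFin k) → T f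
  linked⇒f any with satisfied any
  ... | j′ , inj₁ (_ , j↦j′) = subst T (sym (proj₁ (tag-injective f true (trans (sym j↦fℓ) j↦j′)))) _
  ... | j′ , inj₂ (c↦j′ , _) = ⊥-elim (tag-flag-≢ j′ c (sym c↦j′))
  f⇒linked : T f → Any (λ j′ → Linked (tag false c) (tag true j′) (tag false c) (cwLabel E j)) (allFin k)
  f⇒linked Tf with refl ← T-≡ .Equivalence.to Tf =
    Any.map (λ ℓ≡j′ → inj₁ (refl , trans j↦fℓ (cong (tag true) ℓ≡j′))) (∈-allFin ℓ)

InCW-fromInverse : ∀ (H : Graph n) (γ : Fin n ↔ Fin m) (F : CWExpr k m) →
  (∀ i j → adj H (Inverse.from γ i) (Inverse.from γ j) ≡ cwEdge F i j) → InCW H k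
InCW-fromInverse {m = m} H γ F F≅H = m , F , γ , λ u v → begin
  adj H u v                         ≡⟨ cong₂ (adj H) (strictlyInverseʳ u) (strictlyInverseʳ v) ⟨
  adj H (from (to u)) (from (to v)) ≡⟨ F≅H (to u) (to v) ⟩
  cwEdge F (to u) (to v)            ∎
  where
  open ≡-Reasoning
  open Inverse γ

InCW-apex : ∀ (H : Graph n) x (γ : Fin n ↔ Fin (suc m)) → Inverse.from γ zero ≡ x →
  ∀ (E : CWExpr (2 * k) m) (c : Fin k) →
  (∀ i j → cwEdge E i j ≡ adj H (Inverse.from γ (suc i)) (Inverse.from γ (suc j))) →
  (∀ i → ∃ λ ℓ → cwLabel E i ≡ tag (adj H x (Inverse.from γ (suc i))) ℓ) →
  (∀ i → cwLabel E i ≢ tag false c) →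
  InCW H (2 * k)
InCW-apex {m = m} {k = k} H x γ γ0≡x E c E≅H flagged avoids = InCW-fromInverse H γ F F≅H
  where
  open Inverse γ using (from)
  F : CWExpr (2 * k) (suc m)
  F = addApex c E
  apex-edge : ∀ j → adj H (from zero) (from (suc j)) ≡ cwEdge F zero (suc j)
  apex-edge j with flagged j
  ... | ℓ , j↦ℓ = begin
    adj H (from zero) (from (suc j)) ≡⟨ cong (λ y → adj H y (from (suc j))) γ0≡x ⟩
    adj H x (from (suc j))           ≡⟨ cwEdge-addApex-zero c E j _ ℓ j↦ℓ ⟨
    cwEdge F zero (suc j)            ∎
    where open ≡-Reasoning
  F≅H : ∀ i j → adj H (from i) (from j) ≡ cwEdge F i j
  F≅H zero    zero    = trans (irrefl H (from zero)) (sym (cwEdge-irrefl F zero))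
  F≅H zero    (suc j) = apex-edge j
  F≅H (suc i) zero    = trans (Graph.sym H _ _) (trans (apex-edge i) (cwEdge-sym F zero (suc i)))
  F≅H (suc i) (suc j) = trans (sym (E≅H i j)) (sym (cwEdge-addApex-suc c E avoids i j))

doubleVacant : CWExpr (suc k) m → (Fin m → Bool) → CWExpr (2 * suc k) m
doubleVacant {zero}  E φ = double E φ
doubleVacant {suc k} E φ =
  cw-relab (tag {suc (suc k)} false zero) (tag false (suc zero)) (tag-≢ false false 0≢1+n) (double E φ)

cwEdge-doubleVacant : ∀ (E : CWExpr (suc k) m) φ u v → cwEdge (doubleVacant E φ) u v ≡ cwEdge E u v
cwEdge-doubleVacant {zero}  E φ u v = cwEdge-double E φ u v
cwEdge-doubleVacant {suc k} E φ u v = cwEdge-double E φ u v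

cwLabel-doubleVacant : ∀ (E : CWExpr (suc k) m) φ u →
  ∃ λ (ℓ : Fin (suc k)) → cwLabel (doubleVacant E φ) u ≡ tag (φ u) ℓ
cwLabel-doubleVacant {zero}  E φ u = cwLabel E u , cwLabel-double E φ u
cwLabel-doubleVacant {suc k} E φ u rewrite cwLabel-double E φ u = relabel-tag (φ u) (cwLabel E u)
  where
  relabel-tag : ∀ f (l : Fin (suc (suc k))) →
    ∃ λ ℓ → relabel (tag {suc (suc k)} false zero) (tag false (suc zero)) (tag f l) ≡ tag f ℓ
  relabel-tag true  l =
    l , relabel-fresh {a = tag {suc (suc k)} false zero} {tag false (suc zero)} {tag true l} (tag-flag-≢ l zero)
  relabel-tag false l =
    relabel zero (suc zero) l , relabel-injective (tag-injectiveʳ false false) zero (suc zero) l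

-- With a single label there is no room to move (0, false) away, so it must be unused already.
doubleVacant-vacant : ∀ (E : CWExpr (suc k) m) φ u → (k ≡ 0 → φ u ≡ true) →
  cwLabel (doubleVacant E φ) u ≢ tag {suc k} false zero
doubleVacant-vacant {zero}  E φ u φu≡true eq = tag-flag-≢ (cwLabel E u) zero (begin
  tag true (cwLabel E u)      ≡⟨ cong (λ f → tag f (cwLabel E u)) (φu≡true refl) ⟨
  tag (φ u) (cwLabel E u)     ≡⟨ cwLabel-double E φ u ⟨
  cwLabel (double E φ) u      ≡⟨ eq ⟩
  tag {1} false zero          ∎)
  where open ≡-Reasoning
doubleVacant-vacant {suc k} E φ u _ =
  relabel-≢ (tag-≢ false false {zero} {suc zero} 0≢1+n) (cwLabel (double E φ) u)

InNLC-cong : ∀ {G H : Graph n} → (∀ u v → adj G u v ≡ adj H u v) → InNLC G k → InNLC H k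
InNLC-cong G≗H (m , t , f , t≅G) = m , t , f , λ u v → trans (sym (G≗H u v)) (t≅G u v)

InCW-cong : ∀ {G H : Graph n} → (∀ u v → adj G u v ≡ adj H u v) → InCW G k → InCW H k
InCW-cong G≗H (m , E , f , E≅G) = m , E , f , λ u v → trans (sym (G≗H u v)) (E≅G u v)

adj-subsingleton : ∀ {G H : Graph n} → (∀ u v → u ≡ v) → ∀ u v → adj G u v ≡ adj H u v
adj-subsingleton {G = G} {H} one u v with one u v
... | refl = trans (irrefl G u) (sym (irrefl H u))

InCW-switch : ∀ (G : Graph n) x → InCW G k → InCW (switch G x) (2 * k)
InCW-switch {k = zero}   G x (_ , E , _) = ⊥-elim (CWExpr₀-empty E)
InCW-switch {k = suc k₀} G x (m , E , f , E≅G) with deleteVertex E (Inverse.to f x)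
... | sole only =
  InCW-cong {G = G} {switch G x} (adj-subsingleton {G = G} {switch G x} one-vertex)
    (InCW-double G (m , E , f , E≅G))
  where
  one-vertex : ∀ u v → u ≡ v
  one-vertex u v = Injection.injective (↔⇒↣ f) (trans (only _) (sym (only _)))
... | rest E′ ι ι≢p onto =
  InCW-apex (switch G x) x γ (strictlyInverseʳ x) (doubleVacant E′ φ) zero edges flagged vacant
  where
  open Inverse f
  γ = complement↔ (injective ι) ι≢p onto ↔-∘ f
  w = from ∘ vertex ι
  φ : Fin _ → Bool
  φ i = adj (switch G x) x (w i)
  w≢x : ∀ i → w i ≢ x
  w≢x i wi≡x = ι≢p i (trans (sym (strictlyInverseˡ (vertex ι i))) (cong to wi≡x))
  edges : ∀ i j → cwEdge (doubleVacant E′ φ) i j ≡ adj (switch G x) (w i) (w j)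
  edges i j = begin
    cwEdge (doubleVacant E′ φ) i j          ≡⟨ cwEdge-doubleVacant E′ φ i j ⟩
    cwEdge E′ i j                           ≡⟨ edge ι i j ⟨
    cwEdge E (vertex ι i) (vertex ι j)      ≡⟨ cong₂ (cwEdge E) (strictlyInverseˡ _) (strictlyInverseˡ _) ⟨
    cwEdge E (to (w i)) (to (w j))          ≡⟨ E≅G (w i) (w j) ⟨
    adj G (w i) (w j)                       ≡⟨ switch-away G (w≢x i) (w≢x j) ⟨
    adj (switch G x) (w i) (w j)            ∎
    where open ≡-Reasoning
  flagged = cwLabel-doubleVacant E′ φ
  vacant : ∀ i → cwLabel (doubleVacant E′ φ) i ≢ tag false zero
  vacant i = doubleVacant-vacant E′ φ i λ k₀≡0 → begin
    adj (switch G x) x (w i)                ≡⟨ switch-at G (w≢x i) ⟩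
    not (adj G x (w i))                     ≡⟨ cong not (E≅G x (w i)) ⟩
    not (cwEdge E (to x) (to (w i)))        ≡⟨ cong not (cwEdge-oneLabel (cong suc k₀≡0) E _ _) ⟩
    true                                    ∎
    where open ≡-Reasoning

InNLC-unswitch : ∀ (G : Graph n) x → InNLC (switch G x) k → InNLC G (suc k)
InNLC-unswitch G x =
  InNLC-cong {G = switch (switch G x) x} {G} (switch-involutive G x) ∘ InNLC-switch (switch G x) x

InCW-unswitch : ∀ (G : Graph n) x → InCW (switch G x) k → InCW G (2 * k)
InCW-unswitch G x =
  InCW-cong {G = switch (switch G x) x} {G} (switch-involutive G x) ∘ InCW-switch (switch G x) x

theorem6 : ∀ {n} (G : Graph n) (x : Fin n) (a b c d : ℕ) →
    IsNLCW G a → IsNLCW (switch G x) b →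
    IsCW G c → IsCW (switch G x) d →
    ((a ∸ 1 ≤ b) × (b ≤ a + 1)) × ((c ≤ 2 * d) × (d ≤ 2 * c))
theorem6 G x a b c d (G∈a , a-least) (S∈b , b-least) (G∈c , c-least) (S∈d , d-least) =
  ( m≤n+o⇒m∸n≤o a 1 (a-least (suc b) (InNLC-unswitch G x S∈b))
  , subst (b ≤_) (+-comm 1 a) (b-least (suc a) (InNLC-switch G x G∈a)) )
  , ( c-least (2 * d) (InCW-unswitch G x S∈d)
    , d-least (2 * c) (InCW-switch G x G∈c) )
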